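{- Let $\Gamma$ be a set of genes, $\sigma:\Gamma\to\Sigma$ a species map, $R=(\Gamma,E)$ a relation graph, $S$ a species tree whose leaves include $\sigma(\Gamma)$, and $k\ge0$. Then $R$ is $S$-consistent using $k$ transfers if and only if there exist a least-resolved DS-tree $D$ with $R(D)=R$ and a binary refinement $D'$ of $D$ such that $D'$ is $S$-reconcilable using $k$ transfers. (The same holds with "using $k$ transfers" omitted on both sides.)
   Context: A species network $N$ is a rooted directed acyclic graph whose arcs are partitioned into principal arcs $E_p(N)$ and secondary arcs $E_s(N)$, such that $(V(N),E_p(N))$ is a rooted tree $T_0(N)$ spanning all nodes (the distinguished base tree); endpoints of secondary arcs have one parent and one child in $T_0(N)$; and $N$ is time-consistent: there is $t:V(N)\to\mathbb{Z}$ with $t(u)<t(v)$ for principal arcs $(u,v)$ and $t(u)=t(v)$ for secondary arcs. We write $T_0(N)=S$ when $S$ is obtained from $T_0(N)$ by suppressing nodes with exactly one child. Reconciliation of a rooted binary gene tree $G$ (leaf set $\Gamma$) with $N$: each $u\in V(G)$ gets a sequence $\alpha(u)=(\alpha_1(u),\dots,\alpha_\ell(u))$ of nodes of $N$ and events $e(u,i)$; for $i<\ell$, $(\alpha_i(u),\alpha_{i+1}(u))$ is an arc of $N$ with event $\mathrm{SL}$ (principal arc out of a node with two children in $T_0(N)$), $\emptyset$ (principal arc out of a node with one child in $T_0(N)$) or $\mathrm{TL}$ (secondary arc); a leaf $u$ has $\alpha_\ell(u)=\sigma(u)$; an internal $u$ with children $u',u''$ has last event $\mathrm{S}$ if $\alpha_1(u'),\alpha_1(u'')$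 are the two children of $\alpha_\ell(u)$ in $T_0(N)$, $\mathrm{D}$ if $\alpha_1(u')=\alpha_1(u'')=\alpha_\ell(u)$, and $\mathrm{T}$ if one of $(\alpha_\ell(u),\alpha_1(u'))$, $(\alpha_\ell(u),\alpha_1(u''))$ is secondary and the other principal. The number of transfers counts pairs $(u,i)$ with $e(u,i)\in\{\mathrm{T},\mathrm{TL}\}$. $G$ with $\alpha$ displays $R$ if, after replacing each event $\mathrm{T}$ by $\mathrm{TS}$ or $\mathrm{TD}$ suitably, for all distinct $x,y\in\Gamma$ we have $xy\in E$ iff the last event of $\mathrm{lca}_G(x,y)$ is in $\{\mathrm{S},\mathrm{TS}\}$. $R$ is $N$-consistent using $k$ transfers if some gene tree on $\Gamma$ has a reconciliation with $N$ using $k$ transfers displaying $R$; $R$ is $S$-consistent (using $k$ transfers) if it is $N$-consistent (using $k$ transfers) for some species network $N$ with $T_0(N)=S$. A DS-tree: rooted tree $D$ with leaf set $\Gamma$, internal labels $l(u)\in\{\mathrm{S},\mathrm{D}\}$; $R(D)$ has edge $xy$ iff $l(\mathrm{lca}_D(x,y))=\mathrm{S}$; least-resolved means no arc joins two internal nodes of equal label; a binary refinement of $D$ is a binary DS-tree from which $D$ arises by contracting arcs between equally labelled internal nodes. A binary DS-tree $D'$ is $N$-reconcilable using $k$ transfers if some reconciliation with $N$ uses $k$ transfers and satisfies $l(u)=\mathrm{S}\Rightarrow$ last event of $u$ in $\{\mathrm{S},\mathrm{T}\}$ and $l(u)=\mathrm{D}\Rightarrow$ last event in $\{\mathrm{D},\mathrm{T}\}$;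 it is $S$-reconcilable (using $k$ transfers) if it is $N$-reconcilable (using $k$ transfers) for some species network $N$ with $T_0(N)=S$. -}

module Defs where

open import Data.Nat using (ℕ; zero; suc; _+_)
open import Data.Integer as ℤ using (ℤ)
open import Data.Fin using (Fin; zero; suc; inject₁; fromℕ)
open import Data.Maybe using (Maybe; just; nothing)
open import Data.Product using (Σ; ∃; ∃-syntax; _×_; _,_)
open import Data.Sum using (_⊎_)
open import Data.Unit using (⊤)
open import Data.Empty using (⊥)
open import Data.Bool using (Bool; true; false)
open import Relation.Nullary using (¬_)
open import Relation.Binary.PropositionalEquality using (_≡_; _≢_)
open import Relation.Binary.Construct.Closure.Transitive using (TransClosure)
open import Function.Bundles using (_⇔_)

ΣFin : (n : ℕ) → (Fin n → ℕ) → ℕ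
ΣFin zero    f = 0
ΣFin (suc n) f = f zero + ΣFin n (λ i → f (suc i))

up : ∀ {n} → (Fin n → Maybe (Fin n)) → ℕ → Fin n → Maybe (Fin n)
up p zero    v = just v
up p (suc k) v with p v
... | nothing = nothing
... | just w  = up p k w

record RTree (n : ℕ) : Set where
  field
    root        : Fin n
    parent      : Fin n → Maybe (Fin n)
    root-parent : parent root ≡ nothing
    only-root   : ∀ v → parent v ≡ nothing → v ≡ root
    reach-root  : ∀ v → ∃[ k ] up parent k v ≡ just root

module _ {n : ℕ} (T : RTree n) where
  open RTree T

  Child : Fin n → Fin n → Set
  Child u v = parent v ≡ just u

  Leaf : Fin n → Set
  Leaf u = ∀ v → ¬ Child u v

  Anc : Fin n → Fin n → Set
  Anc u v = ∃[ k ] up parent k v ≡ just u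

  PAnc : Fin n → Fin n → Set
  PAnc u v = ∃[ k ] up parent (suc k) v ≡ just u

  OneChild : Fin n → Set
  OneChild u = ∃[ c ] (Child u c × (∀ c′ → Child u c′ → c′ ≡ c))

  TwoChildren : Fin n → Fin n → Fin n → Set
  TwoChildren u a b =
    a ≢ b × Child u a × Child u b × (∀ c → Child u c → c ≡ a ⊎ c ≡ b)

  HasTwoChildren : Fin n → Set
  HasTwoChildren u = ∃[ a ] ∃[ b ] TwoChildren u a b

  IsLCA : Fin n → Fin n → Fin n → Set
  IsLCA a b c = Anc c a × Anc c b × (∀ d → Anc d a → Anc d b → Anc d c)

  Binary : Set
  Binary = ∀ u → Leaf u ⊎ HasTwoChildren u

  -- u is the nearest proper ancestor of w that does not have exactly one
  -- child (used to describe suppression of nodes with one child)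
  NearestBranch : Fin n → Fin n → Set
  NearestBranch u w =
    PAnc u w × ¬ OneChild u × (∀ z → PAnc u z → PAnc z w → OneChild z)

record LTree (g : ℕ) : Set where
  field
    size   : ℕ
    tree   : RTree size
    leafOf : Fin g → Fin size
    leafOf-leaf : ∀ x → Leaf tree (leafOf x)
    leafOf-inj  : ∀ x y → leafOf x ≡ leafOf y → x ≡ y
    leafOf-onto : ∀ v → Leaf tree v → ∃[ x ] leafOf x ≡ v

record GeneTree (g : ℕ) : Set where
  field
    ltree  : LTree g
    binary : Binary (LTree.tree ltree)

NArc : ∀ {n} → RTree n → (Fin n → Fin n → Set) → Fin n → Fin n → Set
NArc T Sec u v = Child T u v ⊎ Sec u v

record SNet {ns : ℕ} (S : RTree ns) : Set₁ where
  field
    n    : ℕ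
    T₀   : RTree n
    Sec  : Fin n → Fin n → Set
    sec-not-principal : ∀ u v → Sec u v → ¬ Child T₀ u v
    sec-src : ∀ u v → Sec u v →
      (∃[ p ] RTree.parent T₀ u ≡ just p) × OneChild T₀ u
    sec-tgt : ∀ u v → Sec u v →
      (∃[ p ] RTree.parent T₀ v ≡ just p) × OneChild T₀ v
    acyclic : ∀ v → ¬ TransClosure (NArc T₀ Sec) v v
    time-consistent : Σ (Fin n → ℤ) λ t →
      ((∀ u v → Child T₀ u v → t u ℤ.< t v) × (∀ u v → Sec u v → t u ≡ t v))
    -- T₀(N) = S: S is obtained from T₀(N) by suppressing the nodes with
    -- exactly one child; φ identifies the nodes of S with the remaining
    -- nodes of T₀(N).
    φ       : Fin ns → Fin n
    φ-inj   : ∀ a b → φ a ≡ φ b → a ≡ b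
    φ-keep  : ∀ a → ¬ OneChild T₀ (φ a)
    φ-onto  : ∀ v → ¬ OneChild T₀ v → ∃[ a ] φ a ≡ v
    φ-arc   : ∀ a b → (RTree.parent S b ≡ just a) ⇔ NearestBranch T₀ (φ a) (φ b)

data StepEv : Set where
  SL ∅ TL : StepEv

data LastEv : Set where
  evS evD evT : LastEv
  evLeaf : LastEv     -- a leaf of the gene tree (no event)

module _ {ns : ℕ} {S : RTree ns} (N : SNet S) where
  open SNet N

  StepOK : Fin n → Fin n → StepEv → Set
  StepOK x y SL = Child T₀ x y × HasTwoChildren T₀ x
  StepOK x y ∅  = Child T₀ x y × OneChild T₀ x
  StepOK x y TL = Sec x y

  -- condition on the last event of an internal node whose last species
  -- node is z and whose children start at y₁ and y₂
  InnerOK : Fin n → Fin n → Fin n → LastEv → Set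
  InnerOK z y₁ y₂ evS = TwoChildren T₀ z y₁ y₂
  InnerOK z y₁ y₂ evD = y₁ ≡ z × y₂ ≡ z
  InnerOK z y₁ y₂ evT = (Sec z y₁ × Child T₀ z y₂) ⊎ (Child T₀ z y₁ × Sec z y₂)
  InnerOK z y₁ y₂ evLeaf = ⊥

tlCount : StepEv → ℕ
tlCount TL = 1
tlCount _  = 0

tCount : LastEv → ℕ
tCount evT = 1
tCount _   = 0

record Recon {g s ns : ℕ} (σ : Fin g → Fin s) {S : RTree ns}
             (λS : Fin ns → Fin s) (N : SNet S) (G : LTree g) : Set where
  open SNet N
  open LTree G
  field
    len   : Fin size → ℕ
    α     : (u : Fin size) → Fin (suc (len u)) → Fin n
    ev    : (u : Fin size) → Fin (len u) → StepEv
    ev-ok : ∀ u i → StepOK N (α u (inject₁ i)) (α u (suc i)) (ev u i)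
    last  : Fin size → LastEv
    leaf-ok : ∀ u → last u ≡ evLeaf →
      Leaf tree u ×
      (∀ x a → leafOf x ≡ u → Leaf S a → λS a ≡ σ x → α u (fromℕ (len u)) ≡ φ a)
    inner-ok : ∀ u → last u ≢ evLeaf →
      ∃[ c₁ ] ∃[ c₂ ] (TwoChildren tree u c₁ c₂ ×
        InnerOK N (α u (fromℕ (len u))) (α c₁ zero) (α c₂ zero) (last u))

  transfers : ℕ
  transfers = ΣFin size (λ u → tCount (last u) + ΣFin (len u) (λ i → tlCount (ev u i)))

-- τ u = true means the event T at u is read as TS, false as TD
SpecLike : LastEv → Bool → Set
SpecLike evS _ = ⊤
SpecLike evT b = b ≡ true
SpecLike _   _ = ⊥

Displays : ∀ {g s ns} {σ : Fin g → Fin s} {S : RTree ns} {λS : Fin ns → Fin s}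
  {N : SNet S} {G : LTree g} → Recon σ λS N G → (Fin g → Fin g → Set) → Set
Displays {g} {G = G} r E = Σ (Fin (LTree.size G) → Bool) λ τ → (∀ (x y : Fin g) → x ≢ y → ∀ c →
  IsLCA (LTree.tree G) (LTree.leafOf G x) (LTree.leafOf G y) c →
  (E x y ⇔ SpecLike (Recon.last r c) (τ c)))

NConsistentK : ∀ {g s ns} (σ : Fin g → Fin s) {S : RTree ns} (λS : Fin ns → Fin s)
  (N : SNet S) (E : Fin g → Fin g → Set) (k : ℕ) → Set
NConsistentK {g} σ λS N E k = Σ (GeneTree g) λ G →
  Σ (Recon σ λS N (GeneTree.ltree G)) λ r → Recon.transfers r ≡ k × Displays r E

SConsistentK : ∀ {g s ns} (σ : Fin g → Fin s) (S : RTree ns) (λS : Fin ns → Fin s)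
  (E : Fin g → Fin g → Set) (k : ℕ) → Set₁
SConsistentK σ S λS E k = Σ (SNet S) λ N → NConsistentK σ λS N E k

SConsistent : ∀ {g s ns} (σ : Fin g → Fin s) (S : RTree ns) (λS : Fin ns → Fin s)
  (E : Fin g → Fin g → Set) → Set₁
SConsistent σ S λS E = Σ (SNet S) λ N → ∃[ k ] NConsistentK σ λS N E k

data DSLabel : Set where
  lS lD : DSLabel

record DSTree (g : ℕ) : Set where
  field
    ltree : LTree g
    label : Fin (LTree.size ltree) → DSLabel   -- only used on internal nodes
  open LTree ltree public

RofDIs : ∀ {g} → DSTree g → (Fin g → Fin g → Set) → Set
RofDIs {g} Dt E = ∀ (x y : Fin g) → x ≢ y → ∀ c →
  IsLCA tree (leafOf x) (leafOf y) c → (E x y ⇔ label c ≡ lS)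
  where open DSTree Dt

LeastResolved : ∀ {g} → DSTree g → Set
LeastResolved Dt = ∀ u v → Child tree u v → ¬ Leaf tree v → label v ≢ label u
  where open DSTree Dt

BinaryDS : ∀ {g} → DSTree g → Set
BinaryDS Dt = Binary (DSTree.tree Dt)

-- D arises from D′ by contracting arcs between equally labelled internal
-- nodes: π maps each node of D′ to the node of D it is merged into.
record Contracts {g : ℕ} (D′ Dt : DSTree g) : Set where
  private
    module D′ = DSTree D′
    module Dt = DSTree Dt
  field
    π        : Fin D′.size → Fin Dt.size
    π-onto   : ∀ w → ∃[ v ] π v ≡ w
    π-root   : π (RTree.root D′.tree) ≡ RTree.root Dt.tree
    π-leaf   : ∀ x → π (D′.leafOf x) ≡ Dt.leafOf x
    π-arc    : ∀ p v → Child D′.tree p v →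
      (π v ≡ π p × ¬ Leaf D′.tree v × D′.label v ≡ D′.label p)
      ⊎ Child Dt.tree (π p) (π v)
    -- only nodes connected by contracted arcs are merged
    π-fiber  : ∀ v w → π v ≡ π w →
      ∃[ u ] (Anc D′.tree u v × Anc D′.tree u w × π u ≡ π v)
    π-label  : ∀ v → ¬ Leaf D′.tree v → Dt.label (π v) ≡ D′.label v

BinaryRefinement : ∀ {g} → DSTree g → DSTree g → Set
BinaryRefinement D′ Dt = BinaryDS D′ × Contracts D′ Dt

LabelOK : DSLabel → LastEv → Set
LabelOK lS evS = ⊤
LabelOK lS evT = ⊤
LabelOK lD evD = ⊤
LabelOK lD evT = ⊤
LabelOK _ _   = ⊥

NReconcilableK : ∀ {g s ns} (σ : Fin g → Fin s) {S : RTree ns} (λS : Fin ns → Fin s)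
  (N : SNet S) (D′ : DSTree g) (k : ℕ) → Set
NReconcilableK σ λS N D′ k = Σ (Recon σ λS N (DSTree.ltree D′)) λ r →
  Recon.transfers r ≡ k ×
  (∀ u → ¬ Leaf (DSTree.tree D′) u → LabelOK (DSTree.label D′ u) (Recon.last r u))

SReconcilableK : ∀ {g s ns} (σ : Fin g → Fin s) (S : RTree ns) (λS : Fin ns → Fin s)
  (D′ : DSTree g) (k : ℕ) → Set₁
SReconcilableK σ S λS D′ k = Σ (SNet S) λ N → NReconcilableK σ λS N D′ k

SReconcilable : ∀ {g s ns} (σ : Fin g → Fin s) (S : RTree ns) (λS : Fin ns → Fin s)
  (D′ : DSTree g) → Set₁
SReconcilable σ S λS D′ = Σ (SNet S) λ N → ∃[ k ] NReconcilableK σ λS N D′ k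

-- A reconciliation displaying R and a reconciliation of a binary DS-tree are the same data read in
-- two ways: an internal gene-tree node is labelled S when its event is S or a T read as TS, and D
-- when it is D or a T read as TD. So the gene tree of a reconciliation displaying R, labelled in this
-- way, is a binary DS-tree D′ with R(D′) = R that is reconciled with the same network using the same
-- transfers, and conversely. Contracting the arcs of D′ between equally labelled internal nodes gives
-- a least-resolved DS-tree D refined by D′. A contraction maps lowest common ancestors of leaves to
-- lowest common ancestors (a common ancestor in D of two images lifts back along both paths, and the
-- lifts meet in one contracted class) and keeps internal labels, so R(D) = R(D′).

module Submission where

open import Defs
open import Data.Bool using (Bool; true; false)
open import Data.Empty using (⊥-elim)
open import Data.Fin using (Fin; zero; suc)
open import Data.Fin.Properties using (any?; all?) renaming (_≟_ to _≟ᶠ_)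
open import Data.Maybe as Maybe using (Maybe; just; nothing)
open import Data.Maybe.Properties using (just-injective; map-just; ≡-dec)
open import Data.Nat using (ℕ; zero; suc; _+_; _≤_; _<_; _≤?_; s≤s)
open import Data.Nat.Properties
  using (≤-reflexive; ≤-refl; ≤-trans; m≤n+m; <-≤-trans; <-irrefl; ≰⇒≥; m≢1+n+m; +-assoc;
         suc-injective)
open import Data.Product using (Σ; ∃; ∃-syntax; _×_; _,_; proj₁; proj₂)
open import Data.Sum using (_⊎_; inj₁; inj₂)
open import Data.Unit using (tt)
open import Function using (_∘_; case_of_)
open import Function.Bundles using (_⇔_; mk⇔; Equivalence)
import Function.Properties.Equivalence as ⇔
open import Relation.Nullary using (¬_; Dec; yes; no; ¬?)
open import Relation.Binary.PropositionalEquality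
  using (_≡_; _≢_; refl; sym; trans; cong; subst; subst₂)

map≡just⁻ : ∀ {A B : Set} {f : A → B} ma {b} → Maybe.map f ma ≡ just b →
  ∃[ a ] (ma ≡ just a × f a ≡ b)
map≡just⁻ (just a) refl = a , refl , refl

map≡nothing⁻ : ∀ {A B : Set} {f : A → B} ma → Maybe.map f ma ≡ nothing → ma ≡ nothing
map≡nothing⁻ nothing _ = refl

record Enumeration {n : ℕ} (P : Fin n → Set) : Set where
  field
    count         : ℕ
    index         : ∀ v → P v → Fin count
    element       : Fin count → Fin n
    element-sat   : ∀ i → P (element i)
    element-index : ∀ v p → element (index v p) ≡ v
    index-element : ∀ i p → index (element i) p ≡ i

  index-element′ : ∀ {i v} → element i ≡ v → ∀ p → index v p ≡ i
  index-element′ refl = index-element _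

enumerate : ∀ {n} {P : Fin n → Set} → (∀ v → Dec (P v)) → Enumeration P
enumerate {zero} _ = record
  { count = 0 ; index = λ () ; element = λ () ; element-sat = λ ()
  ; element-index = λ () ; index-element = λ () }
enumerate {suc n} {P} P? with enumerate (P? ∘ suc) | P? zero
... | E | yes p₀ = record
  { count = suc count ; index = index′ ; element = element′ ; element-sat = element′-sat
  ; element-index = element′-index ; index-element = index′-element′ }
  where
    open Enumeration E
    index′ : ∀ v → P v → Fin (suc count)
    index′ zero    _ = zero
    index′ (suc v) p = suc (index v p)
    element′ : Fin (suc count) → Fin (suc n)
    element′ zero    = zero
    element′ (suc i) = suc (element i)
    element′-sat : ∀ i → P (element′ i)
    element′-sat zero    = p₀
    element′-sat (suc i) = element-sat i
    element′-index : ∀ v p → element′ (index′ v p) ≡ v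
    element′-index zero    _ = refl
    element′-index (suc v) p = cong suc (element-index v p)
    index′-element′ : ∀ i p → index′ (element′ i) p ≡ i
    index′-element′ zero    _ = refl
    index′-element′ (suc i) p = cong suc (index-element i p)
... | E | no ¬p₀ = record
  { count = count ; index = index′ ; element = suc ∘ element ; element-sat = element-sat
  ; element-index = element′-index ; index-element = index-element }
  where
    open Enumeration E
    index′ : ∀ v → P v → Fin count
    index′ zero    p = ⊥-elim (¬p₀ p)
    index′ (suc v) p = index v p
    element′-index : ∀ v p → suc (element (index′ v p)) ≡ v
    element′-index zero    p = ⊥-elim (¬p₀ p)
    element′-index (suc v) p = cong suc (element-index v p)

argmax : ∀ {n} {P : Fin n → Set} → (∀ v → Dec (P v)) → (f : Fin n → ℕ) → ∃ P →
  ∃[ w ] (P w × (∀ w′ → P w′ → f w′ ≤ f w))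
argmax {suc n} {P} P? f (w₀ , p₀) with any? (P? ∘ suc)
... | no none = zero , at-zero w₀ p₀ , λ { zero _ → ≤-refl ; (suc j) pj → ⊥-elim (none (j , pj)) }
  where
    at-zero : ∀ w → P w → P zero
    at-zero zero    p = p
    at-zero (suc j) p = ⊥-elim (none (j , p))
... | yes some with argmax (P? ∘ suc) (f ∘ suc) some | P? zero
... | w , pw , max | no ¬p₀ = suc w , pw , λ { zero p → ⊥-elim (¬p₀ p) ; (suc j) pj → max j pj }
... | w , pw , max | yes p₀′ with f zero ≤? f (suc w)
... | yes ≤w = suc w , pw , λ { zero _ → ≤w ; (suc j) pj → max j pj }
... | no  ≰w = zero , p₀′ , λ { zero _ → ≤-refl ; (suc j) pj → ≤-trans (max j pj) (≰⇒≥ ≰w) }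

-- Rooted trees

module Up {n : ℕ} (p : Fin n → Maybe (Fin n)) where

  up-suc : ∀ {u v} k → p v ≡ just u → up p (suc k) v ≡ up p k u
  up-suc k eq rewrite eq = refl

  up-suc-inv : ∀ k {v w} → up p (suc k) v ≡ just w → ∃[ u ] (p v ≡ just u × up p k u ≡ just w)
  up-suc-inv k {v} e with p v
  ... | just u = u , refl , e

  up-+ : ∀ k j {v u w} → up p k v ≡ just u → up p j u ≡ just w → up p (k + j) v ≡ just w
  up-+ zero    j refl e′ = e′
  up-+ (suc k) j e e′ with up-suc-inv k e
  ... | _ , pv , e″ = trans (up-suc (k + j) pv) (up-+ k j e″ e′)

  up-suc-last : ∀ k {v w} → up p (suc k) v ≡ just w → ∃[ u ] (up p k v ≡ just u × p u ≡ just w)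
  up-suc-last zero e with up-suc-inv zero e
  ... | _ , pv , refl = _ , refl , pv
  up-suc-last (suc k) e with up-suc-inv (suc k) e
  ... | _ , pv , e′ with up-suc-last k e′
  ... | u , e″ , pu = u , trans (up-suc k pv) e″ , pu

module RTreeProperties {n : ℕ} (T : RTree n) where
  open RTree T
  open Up parent

  up-suc-root : ∀ k → up parent (suc k) root ≡ nothing
  up-suc-root k rewrite root-parent = refl

  up-root-unique : ∀ k j {v} → up parent k v ≡ just root → up parent j v ≡ just root → k ≡ j
  up-root-unique zero    zero    _  _ = refl
  up-root-unique zero    (suc j) refl e with () ← trans (sym e) (up-suc-root j)
  up-root-unique (suc k) zero    e refl with () ← trans (sym e) (up-suc-root k)
  up-root-unique (suc k) (suc j) e e′ with up-suc-inv k e | up-suc-inv j e′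
  ... | _ , pv , e″ | _ , pv′ , e‴ with refl ← trans (sym pv) pv′ = cong suc (up-root-unique k j e″ e‴)

  depth : Fin n → ℕ
  depth v = proj₁ (reach-root v)

  depth-up : ∀ k {a b} → up parent k b ≡ just a → depth b ≡ k + depth a
  depth-up k {a} {b} e = up-root-unique _ _ (proj₂ (reach-root b)) (up-+ k (depth a) e (proj₂ (reach-root a)))

  depth-child : ∀ {u v} → Child T u v → depth v ≡ suc (depth u)
  depth-child c = depth-up 1 (up-suc 0 c)

  depth≡0⇒root : ∀ {v} → depth v ≡ 0 → v ≡ root
  depth≡0⇒root {v} d with proj₂ (reach-root v)
  ... | e rewrite d = just-injective e

  parent-unique : ∀ {u u′ v} → Child T u v → Child T u′ v → u ≡ u′
  parent-unique c c′ = just-injective (trans (sym c) c′)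

  parent-internal : ∀ {u v} → Child T u v → ¬ Leaf T u
  parent-internal {v = v} c leaf = leaf v c

  anc-refl : ∀ v → Anc T v v
  anc-refl v = 0 , refl

  anc-trans : ∀ {a b c} → Anc T a b → Anc T b c → Anc T a c
  anc-trans (k , e) (j , e′) = j + k , up-+ j k e′ e

  child⇒anc : ∀ {u v} → Child T u v → Anc T u v
  child⇒anc c = 1 , up-suc 0 c

  anc⇒depth-≤ : ∀ {a b} → Anc T a b → depth a ≤ depth b
  anc⇒depth-≤ {a} (k , e) = subst (depth a ≤_) (sym (depth-up k e)) (m≤n+m (depth a) k)

  anc-antisym : ∀ {a b} → Anc T a b → Anc T b a → a ≡ b
  anc-antisym (zero , refl) _ = refl
  anc-antisym {a} {b} (suc k , e) (j , e′) = ⊥-elim (m≢1+n+m (depth b) cycle)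
    where
      cycle : depth b ≡ suc (k + j + depth b)
      cycle = trans (depth-up (suc k) e)
        (trans (cong (λ d → suc (k + d)) (depth-up j e′)) (cong suc (sym (+-assoc k j (depth b)))))

  anc-linear : ∀ {v a b} → Anc T a v → Anc T b v → Anc T a b ⊎ Anc T b a
  anc-linear (k , e) (j , e′) = go k j e e′
    where
      go : ∀ k j {v a b} → up parent k v ≡ just a → up parent j v ≡ just b → Anc T a b ⊎ Anc T b a
      go zero    j       refl e′   = inj₂ (j , e′)
      go (suc k) zero    e    refl = inj₁ (suc k , e)
      go (suc k) (suc j) e    e′ with up-suc-inv k e | up-suc-inv j e′
      ... | _ , pv , e″ | _ , pv′ , e‴ with refl ← trans (sym pv) pv′ = go k j e″ e‴

  leaf-anc⇒≡ : ∀ {a v} → Leaf T a → Anc T a v → v ≡ a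
  leaf-anc⇒≡ _    (zero  , refl) = refl
  leaf-anc⇒≡ leaf (suc k , e) with up-suc-last k e
  ... | u , _ , pu = ⊥-elim (leaf u pu)

  anc-of-child : ∀ {a u v} → Child T u v → Anc T a v → a ≡ v ⊎ Anc T a u
  anc-of-child _ (zero  , refl) = inj₁ refl
  anc-of-child c (suc j , e) with up-suc-inv j e
  ... | _ , pv , e′ with refl ← parent-unique c pv = inj₂ (j , e′)

  anc? : ∀ a b → Dec (Anc T a b)
  anc? a b = go (depth b) b (proj₂ (reach-root b))
    where
      go : ∀ k b → up parent k b ≡ just root → Dec (Anc T a b)
      go zero b refl with a ≟ᶠ root
      ... | yes refl = yes (anc-refl root)
      ... | no a≢root = no λ where
        (zero  , refl) → a≢root refl
        (suc j , e)    → case trans (sym e) (up-suc-root j) of λ ()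
      go (suc k) b e with b ≟ᶠ a | up-suc-inv k e
      ... | yes refl | _ = yes (anc-refl b)
      ... | no b≢a | u , pb , e′ with go k u e′
      ... | yes au = yes (anc-trans au (child⇒anc pb))
      ... | no ¬au = no λ ab → case anc-of-child pb ab of λ where
        (inj₁ a≡b) → b≢a (sym a≡b)
        (inj₂ au)  → ¬au au

  lca-exists : ∀ a b → ∃[ c ] IsLCA T a b c
  lca-exists a b = go (depth a) a (proj₂ (reach-root a))
    where
      go : ∀ k a → up parent k a ≡ just root → ∃[ c ] IsLCA T a b c
      go zero    a refl = root , anc-refl root , reach-root b , λ _ da _ → da
      go (suc k) a e with anc? a b | up-suc-inv k e
      ... | yes ab | _ = a , anc-refl a , ab , λ _ da _ → da
      ... | no ¬ab | u , pa , e′ with go k u e′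
      ... | c , cu , cb , least = c , anc-trans cu (child⇒anc pa) , cb , least′
        where
          least′ : ∀ d → Anc T d a → Anc T d b → Anc T d c
          least′ d da db with anc-of-child pa da
          ... | inj₁ refl = ⊥-elim (¬ab db)
          ... | inj₂ du   = least d du db

  lca-unique : ∀ {a b c d} → IsLCA T a b c → IsLCA T a b d → c ≡ d
  lca-unique (ca , cb , c-least) (da , db , d-least) = anc-antisym (d-least _ ca cb) (c-least _ da db)

  leaf? : ∀ v → Dec (Leaf T v)
  leaf? v = all? λ c → ¬? (≡-dec _≟ᶠ_ (parent c) (just v))

  internal⇒child : ∀ {v} → ¬ Leaf T v → ∃[ c ] Child T v c
  internal⇒child {v} internal with any? (λ c → ≡-dec _≟ᶠ_ (parent c) (just v))
  ... | yes child = child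
  ... | no  ¬child = ⊥-elim (internal λ c pc → ¬child (c , pc))

lca-leaves-internal : ∀ {g} (G : LTree g) {x y c} → x ≢ y →
  IsLCA (LTree.tree G) (LTree.leafOf G x) (LTree.leafOf G y) c → ¬ Leaf (LTree.tree G) c
lca-leaves-internal G {x} {y} x≢y (cx , cy , _) leaf =
  x≢y (LTree.leafOf-inj G x y (trans (leaf-anc⇒≡ leaf cx) (sym (leaf-anc⇒≡ leaf cy))))
  where open RTreeProperties (LTree.tree G)

-- Contractions of DS-trees

module ContractionProperties {g : ℕ} {D′ D : DSTree g} (C : Contracts D′ D) where
  private
    module D′ = DSTree D′
    module D = DSTree D
    module T′ = RTreeProperties D′.tree
    module T = RTreeProperties D.tree
  open Contracts C

  π-anc : ∀ {u v} → Anc D′.tree u v → Anc D.tree (π u) (π v)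
  π-anc (k , e) = go k e
    where
      go : ∀ k {u v} → up (RTree.parent D′.tree) k v ≡ just u → Anc D.tree (π u) (π v)
      go zero refl = T.anc-refl _
      go (suc k) {u} {v} e with Up.up-suc-inv (RTree.parent D′.tree) k e
      ... | w , pv , e′ with π-arc w v pv
      ... | inj₁ (πv≡πw , _) = subst (Anc D.tree (π u)) (sym πv≡πw) (go k e′)
      ... | inj₂ child       = T.anc-trans (go k e′) (T.child⇒anc child)

  -- π maps the path from c down to v onto the path from π c down to π v.
  anc-lift : ∀ {c v w} → Anc D′.tree c v → Anc D.tree (π c) w → Anc D.tree w (π v) →
    ∃[ v′ ] (Anc D′.tree v′ v × π v′ ≡ w)
  anc-lift (k , e) = go k e
    where
      above : ∀ {u v w} → Child D′.tree u v →
        ∃[ v′ ] (Anc D′.tree v′ u × π v′ ≡ w) → ∃[ v′ ] (Anc D′.tree v′ v × π v′ ≡ w)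
      above uv (v′ , v′u , πv′) = v′ , T′.anc-trans v′u (T′.child⇒anc uv) , πv′

      go : ∀ k {c v w} → up (RTree.parent D′.tree) k v ≡ just c →
        Anc D.tree (π c) w → Anc D.tree w (π v) →
        ∃[ v′ ] (Anc D′.tree v′ v × π v′ ≡ w)
      go zero refl cw wv = _ , T′.anc-refl _ , T.anc-antisym cw wv
      go (suc k) {v = v} {w} e cw wv with Up.up-suc-inv (RTree.parent D′.tree) k e
      ... | u , pv , e′ = case π-arc u v pv of λ where
        (inj₁ (πv≡πu , _)) → above pv (go k e′ cw (subst (Anc D.tree w) πv≡πu wv))
        (inj₂ child) → case T.anc-of-child child wv of λ where
          (inj₁ refl) → v , T′.anc-refl v , refl
          (inj₂ wu)   → above pv (go k e′ cw wu)

  lca-preserved : ∀ {a b c} → IsLCA D′.tree a b c → IsLCA D.tree (π a) (π b) (π c)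
  lca-preserved {a} {b} {c} (ca , cb , c-least) = π-anc ca , π-anc cb , least
    where
      least : ∀ d → Anc D.tree d (π a) → Anc D.tree d (π b) → Anc D.tree d (π c)
      least d da db with T.anc-linear da (π-anc ca)
      ... | inj₁ dc = dc
      ... | inj₂ cd with anc-lift ca cd da | anc-lift cb cd db
      ... | v , va , πv | w , wb , πw with π-fiber v w (trans πv (sym πw))
      ... | u , uv , uw , πu = subst (λ z → Anc D.tree z (π c)) (trans πu πv)
                                 (π-anc (c-least u (T′.anc-trans uv va) (T′.anc-trans uw wb)))

  lca-leaves-preserved : ∀ {x y c} → IsLCA D′.tree (D′.leafOf x) (D′.leafOf y) c →
    IsLCA D.tree (D.leafOf x) (D.leafOf y) (π c)
  lca-leaves-preserved {x} {y} lca =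
    subst₂ (λ a b → IsLCA D.tree a b _) (π-leaf x) (π-leaf y) (lca-preserved lca)

  R-preserved : ∀ {E : Fin g → Fin g → Set} → RofDIs D E ⇔ RofDIs D′ E
  R-preserved {E} = mk⇔ to from
    where
      label≡ : ∀ {x y c} → x ≢ y → IsLCA D′.tree (D′.leafOf x) (D′.leafOf y) c →
        D.label (π c) ≡ D′.label c
      label≡ x≢y lca = π-label _ (lca-leaves-internal D′.ltree x≢y lca)

      to : RofDIs D E → RofDIs D′ E
      to R x y x≢y c lca = subst (λ l → E x y ⇔ l ≡ lS) (label≡ x≢y lca)
                             (R x y x≢y (π c) (lca-leaves-preserved lca))

      from : RofDIs D′ E → RofDIs D E
      from R′ x y x≢y d lca with T′.lca-exists (D′.leafOf x) (D′.leafOf y)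
      ... | c , lca′ with refl ← T.lca-unique (lca-leaves-preserved lca′) lca =
        subst (λ l → E x y ⇔ l ≡ lS) (sym (label≡ x≢y lca′)) (R′ x y x≢y c lca′)

_≟ˡ_ : (a b : DSLabel) → Dec (a ≡ b)
lS ≟ˡ lS = yes refl
lS ≟ˡ lD = no λ ()
lD ≟ˡ lS = no λ ()
lD ≟ˡ lD = yes refl

module Contraction {g : ℕ} (D : DSTree g) where
  open DSTree D
  open RTree tree
  open RTreeProperties tree

  Merged : Fin size → Set
  Merged v = ∃[ u ] (Child tree u v × ¬ Leaf tree v × label v ≡ label u)

  Merged? : ∀ v → Dec (Merged v)
  Merged? v with parent v
  ... | nothing = no λ { (_ , () , _) }
  ... | just u with leaf? v | label v ≟ˡ label u
  ... | yes leaf     | _          = no λ (_ , _ , internal , _) → internal leaf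
  ... | no  internal | yes same   = yes (u , refl , internal , same)
  ... | no  _        | no  differ =
    no λ (_ , c , _ , same) → differ (subst (λ w → label v ≡ label w) (sym (just-injective c)) same)

  root-unmerged : ¬ Merged root
  root-unmerged (_ , c , _) = case trans (sym root-parent) c of λ ()

  leaf-unmerged : ∀ {v} → Leaf tree v → ¬ Merged v
  leaf-unmerged leaf (_ , _ , internal , _) = internal leaf

  -- Climbs along merged arcs; the fuel depth v always suffices.
  top : ℕ → Fin size → Fin size
  top zero    v = v
  top (suc f) v with Merged? v
  ... | yes (u , _) = top f u
  ... | no  _       = v

  top-unmerged : ∀ f {v} → ¬ Merged v → top f v ≡ v
  top-unmerged zero    _  = refl
  top-unmerged (suc f) {v} ¬m with Merged? v
  ... | yes m = ⊥-elim (¬m m)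
  ... | no  _ = refl

  top-merged : ∀ f {u v} → Child tree u v → Merged v → top (suc f) v ≡ top f u
  top-merged f {v = v} c m with Merged? v
  ... | yes (_ , c′ , _) = cong (top f) (parent-unique c′ c)
  ... | no  ¬m           = ⊥-elim (¬m m)

  top-spec : ∀ f v → depth v ≡ f →
    ¬ Merged (top f v) × Anc tree (top f v) v × (¬ Leaf tree v → label (top f v) ≡ label v)
  top-spec zero v d with refl ← depth≡0⇒root d = root-unmerged , anc-refl root , λ _ → refl
  top-spec (suc f) v d with Merged? v
  ... | no ¬m = ¬m , anc-refl v , λ _ → refl
  ... | yes (u , c , _ , same) with top-spec f u (suc-injective (trans (sym (depth-child c)) d))
  ... | unmerged , anc , same′ =
    unmerged , anc-trans anc (child⇒anc c) , λ _ → trans (same′ (parent-internal c)) (sym same)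

  rep : Fin size → Fin size
  rep v = top (depth v) v

  rep-unmerged : ∀ v → ¬ Merged (rep v)
  rep-unmerged v = proj₁ (top-spec (depth v) v refl)

  rep-anc : ∀ v → Anc tree (rep v) v
  rep-anc v = proj₁ (proj₂ (top-spec (depth v) v refl))

  rep-label : ∀ v → ¬ Leaf tree v → label (rep v) ≡ label v
  rep-label v = proj₂ (proj₂ (top-spec (depth v) v refl))

  rep-unmerged-id : ∀ {v} → ¬ Merged v → rep v ≡ v
  rep-unmerged-id {v} = top-unmerged (depth v)

  rep-merged : ∀ {u v} → Child tree u v → Merged v → rep v ≡ rep u
  rep-merged {v = v} c m = trans (cong (λ f → top f v) (depth-child c)) (top-merged _ c m)

  rep-idem : ∀ v → rep (rep v) ≡ rep v
  rep-idem v = rep-unmerged-id (rep-unmerged v)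

  open Enumeration (enumerate {P = λ v → ¬ Merged v} (¬? ∘ Merged?))

  π : Fin size → Fin count
  π v = index (rep v) (rep-unmerged v)

  element-π : ∀ v → element (π v) ≡ rep v
  element-π v = element-index (rep v) (rep-unmerged v)

  π-cong : ∀ {v w} → rep v ≡ rep w → π v ≡ π w
  π-cong {w = w} e = index-element′ (trans (element-π w) (sym e)) _

  π-element : ∀ i → π (element i) ≡ i
  π-element i = index-element′ (sym (rep-unmerged-id (element-sat i))) _

  element-π-unmerged : ∀ {v} → ¬ Merged v → element (π v) ≡ v
  element-π-unmerged ¬m = trans (element-π _) (rep-unmerged-id ¬m)

  π-rep : ∀ v → π (rep v) ≡ π v
  π-rep v = π-cong (rep-idem v)

  π-injective-rep : ∀ {v w} → π v ≡ π w → rep v ≡ rep w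
  π-injective-rep {v} {w} e = trans (sym (element-π v)) (trans (cong element e) (element-π w))

  parent′ : Fin count → Maybe (Fin count)
  parent′ i = Maybe.map π (parent (element i))

  parent′-π-child : ∀ {u w} → Child tree u w → ¬ Merged w → parent′ (π w) ≡ just (π u)
  parent′-π-child c ¬m = trans (cong (Maybe.map π ∘ parent) (element-π-unmerged ¬m)) (map-just c)

  root′ : Fin count
  root′ = π root

  parent′-root′ : parent′ root′ ≡ nothing
  parent′-root′ = trans (cong (Maybe.map π ∘ parent) (element-π-unmerged root-unmerged)) (cong (Maybe.map π) root-parent)

  only-root′ : ∀ i → parent′ i ≡ nothing → i ≡ root′
  only-root′ i e = trans (sym (π-element i)) (cong π (only-root _ (map≡nothing⁻ _ e)))

  reach-root′ : ∀ f v → depth v < f → ∃[ k ] up parent′ k (π v) ≡ just root′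
  reach-root′ (suc f) v (s≤s d) with parent (rep v) in prv
  ... | nothing = 0 , cong just (trans (sym (π-rep v)) (cong π (only-root _ prv)))
  ... | just u with reach-root′ f u (<-≤-trans (parent-below prv) d)
    where
      parent-below : ∀ {u} → Child tree u (rep v) → depth u < depth v
      parent-below c = ≤-trans (≤-reflexive (sym (depth-child c))) (anc⇒depth-≤ (rep-anc v))
  ... | k , e = suc k , trans (Up.up-suc parent′ k step) e
    where
      step : parent′ (π v) ≡ just (π u)
      step = trans (cong parent′ (sym (π-rep v))) (parent′-π-child prv (rep-unmerged v))

  tree′ : RTree count
  tree′ = record
    { root = root′ ; parent = parent′ ; root-parent = parent′-root′ ; only-root = only-root′
    ; reach-root = λ i → subst (λ j → ∃[ k ] up parent′ k j ≡ just root′) (π-element i)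
                               (reach-root′ _ (element i) ≤-refl) }

  rep-leaf : ∀ {v} → Leaf tree v → rep v ≡ v
  rep-leaf leaf = rep-unmerged-id (leaf-unmerged leaf)

  leaf-π : ∀ {w} → Leaf tree w → Leaf tree′ (π w)
  leaf-π {w} leaf j c with map≡just⁻ (parent (element j)) c
  ... | u , pu , πu≡πw = leaf (element j) (subst (λ x → Child tree x (element j)) u≡w pu)
    where
      u≡w : u ≡ w
      u≡w = leaf-anc⇒≡ leaf
        (subst (λ r → Anc tree r u) (trans (π-injective-rep πu≡πw) (rep-leaf leaf)) (rep-anc u))

  HangsBelow : Fin count → Fin size → Set
  HangsBelow i w = ∃[ u ] (Child tree u w × rep u ≡ element i)

  HangsBelow? : ∀ i w → Dec (HangsBelow i w)
  HangsBelow? i w with parent w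
  ... | nothing = no λ { (_ , () , _) }
  ... | just u with rep u ≟ᶠ element i
  ... | yes ru = yes (u , refl , ru)
  ... | no ¬ru = no λ (_ , c , ru) → ¬ru (subst (λ x → rep x ≡ element i) (sym (just-injective c)) ru)

  -- A deepest node hanging below the class of element i cannot be merged,
  -- since its children would hang below that class too; so it yields a child of i.
  element-leaf : ∀ {i} → Leaf tree′ i → Leaf tree (element i)
  element-leaf {i} leaf′ c pc
    with argmax (HangsBelow? i) depth (c , element i , pc , rep-unmerged-id (element-sat i))
  ... | w , (u , pw , ru) , deepest with Merged? w
  ... | no ¬m = leaf′ (π w) (trans (parent′-π-child pw ¬m) (cong just (index-element′ (sym ru) _)))
  ... | yes m@(_ , _ , internal , _) with internal⇒child internal
  ... | a , pa = <-irrefl refl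
    (<-≤-trans (≤-reflexive (sym (depth-child pa))) (deepest a (w , pa , trans (rep-merged pw m) ru)))

  ltree′ : LTree g
  ltree′ = record
    { size = count ; tree = tree′ ; leafOf = π ∘ leafOf
    ; leafOf-leaf = λ x → leaf-π (leafOf-leaf x)
    ; leafOf-inj = λ x y e → leafOf-inj x y
        (trans (sym (rep-leaf (leafOf-leaf x))) (trans (π-injective-rep e) (rep-leaf (leafOf-leaf y))))
    ; leafOf-onto = onto }
    where
      onto : ∀ i → Leaf tree′ i → ∃[ x ] π (leafOf x) ≡ i
      onto i leaf′ with leafOf-onto (element i) (element-leaf leaf′)
      ... | x , e = x , trans (cong π e) (π-element i)

  contracted : DSTree g
  contracted = record { ltree = ltree′ ; label = label ∘ element }

  contracted-leastResolved : LeastResolved contracted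
  contracted-leastResolved i j c internal′ same with map≡just⁻ (parent (element j)) c
  ... | u , pu , refl = element-sat j (u , pu , internal , same-as-parent)
    where
      same-as-parent : label (element j) ≡ label u
      same-as-parent = trans same (trans (cong label (element-π u)) (rep-label u (parent-internal pu)))

      internal : ¬ Leaf tree (element j)
      internal leaf = internal′ (subst (Leaf tree′) (π-element j) (leaf-π leaf))

  contraction : Contracts D contracted
  contraction = record
    { π = π ; π-onto = λ i → element i , π-element i ; π-root = refl ; π-leaf = λ _ → refl
    ; π-arc = arc
    ; π-fiber = λ v w e →
        rep v , rep-anc v , subst (λ r → Anc tree r w) (sym (π-injective-rep e)) (rep-anc w) , π-rep v
    ; π-label = λ v internal → trans (cong label (element-π v)) (rep-label v internal) }
    where
      arc : ∀ q v → Child tree q v →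
        (π v ≡ π q × ¬ Leaf tree v × label v ≡ label q) ⊎ Child tree′ (π q) (π v)
      arc q v c with Merged? v
      ... | yes m@(_ , c′ , internal , same) with refl ← parent-unique c′ c =
        inj₁ (π-cong (rep-merged c m) , internal , same)
      ... | no ¬m = inj₂ (parent′-π-child c ¬m)

-- DS-labels read off reconciliations

isS : DSLabel → Bool
isS lS = true
isS lD = false

-- The flag decides whether T is read as TS or TD; leaves get an arbitrary label, which DS-trees ignore.
eventLabel : LastEv → Bool → DSLabel
eventLabel evS    _     = lS
eventLabel evD    _     = lD
eventLabel evT    true  = lS
eventLabel evT    false = lD
eventLabel evLeaf _     = lD

specLike⇔eventLabel≡lS : ∀ e b → SpecLike e b ⇔ (eventLabel e b ≡ lS)
specLike⇔eventLabel≡lS evS    _     = mk⇔ (λ _ → refl) (λ _ → tt)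
specLike⇔eventLabel≡lS evD    _     = mk⇔ (λ ()) (λ ())
specLike⇔eventLabel≡lS evT    true  = mk⇔ (λ _ → refl) (λ _ → refl)
specLike⇔eventLabel≡lS evT    false = mk⇔ (λ ()) (λ ())
specLike⇔eventLabel≡lS evLeaf _     = mk⇔ (λ ()) (λ ())

labelOK-eventLabel : ∀ e b → e ≢ evLeaf → LabelOK (eventLabel e b) e
labelOK-eventLabel evS    _     _ = tt
labelOK-eventLabel evD    _     _ = tt
labelOK-eventLabel evT    true  _ = tt
labelOK-eventLabel evT    false _ = tt
labelOK-eventLabel evLeaf _     e≢leaf = ⊥-elim (e≢leaf refl)

labelOK⇒≡lS⇔specLike : ∀ l e → LabelOK l e → (l ≡ lS ⇔ SpecLike e (isS l))
labelOK⇒≡lS⇔specLike lS evS _ = mk⇔ (λ _ → tt) (λ _ → refl)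
labelOK⇒≡lS⇔specLike lS evT _ = mk⇔ (λ _ → refl) (λ _ → refl)
labelOK⇒≡lS⇔specLike lD evD _ = mk⇔ (λ ()) (λ ())
labelOK⇒≡lS⇔specLike lD evT _ = mk⇔ (λ ()) (λ ())

module _ {g s ns : ℕ} {σ : Fin g → Fin s} {S : RTree ns} {λS : Fin ns → Fin s} {N : SNet S} where

  eventDSTree : ∀ {G : LTree g} → Recon σ λS N G → (Fin (LTree.size G) → Bool) → DSTree g
  eventDSTree {G} r τ = record { ltree = G ; label = λ u → eventLabel (Recon.last r u) (τ u) }

  eventDSTree-labelOK : ∀ {G : LTree g} (r : Recon σ λS N G) τ u → ¬ Leaf (LTree.tree G) u →
    LabelOK (DSTree.label (eventDSTree r τ) u) (Recon.last r u)
  eventDSTree-labelOK r τ u internal =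
    labelOK-eventLabel (Recon.last r u) (τ u) (λ e → internal (proj₁ (Recon.leaf-ok r u e)))

  displays⇒R-eventDSTree : ∀ {G : LTree g} {E} (r : Recon σ λS N G) τ →
    (∀ x y → x ≢ y → ∀ c → IsLCA (LTree.tree G) (LTree.leafOf G x) (LTree.leafOf G y) c →
      E x y ⇔ SpecLike (Recon.last r c) (τ c)) →
    RofDIs (eventDSTree r τ) E
  displays⇒R-eventDSTree r τ displays x y x≢y c lca =
    ⇔.trans (displays x y x≢y c lca) (specLike⇔eventLabel≡lS (Recon.last r c) (τ c))

  R⇒displays : ∀ {E} (D′ : DSTree g) (r : Recon σ λS N (DSTree.ltree D′)) →
    (∀ u → ¬ Leaf (DSTree.tree D′) u → LabelOK (DSTree.label D′ u) (Recon.last r u)) →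
    RofDIs D′ E → Displays r E
  R⇒displays D′ r labelOK R = isS ∘ DSTree.label D′ , λ x y x≢y c lca →
    ⇔.trans (R x y x≢y c lca)
      (labelOK⇒≡lS⇔specLike _ _ (labelOK c (lca-leaves-internal (DSTree.ltree D′) x≢y lca)))

module _ {g s ns : ℕ} {σ : Fin g → Fin s} {E : Fin g → Fin g → Set} {S : RTree ns} {λS : Fin ns → Fin s}
  where

  ReconcilableRefinement : (DSTree g → Set₁) → Set₁
  ReconcilableRefinement Reconcilable = Σ (DSTree g) λ D → LeastResolved D × RofDIs D E ×
    Σ (DSTree g) λ D′ → BinaryRefinement D′ D × Reconcilable D′

  consistentK⇒refinement : ∀ {k} → SConsistentK σ S λS E k →
    ReconcilableRefinement (λ D′ → SReconcilableK σ S λS D′ k)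
  consistentK⇒refinement (N , G , r , transfers , τ , displays) =
    contracted , contracted-leastResolved , Equivalence.from R-preserved R′ ,
    D′ , (GeneTree.binary G , contraction) , N , r , transfers , eventDSTree-labelOK r τ
    where
      D′ : DSTree g
      D′ = eventDSTree r τ
      R′ : RofDIs D′ E
      R′ = displays⇒R-eventDSTree r τ displays
      open Contraction D′
      open ContractionProperties contraction

  refinement⇒consistentK : ∀ {k} → ReconcilableRefinement (λ D′ → SReconcilableK σ S λS D′ k) →
    SConsistentK σ S λS E k
  refinement⇒consistentK (_ , _ , R , D′ , (binary , C) , N , r , transfers , labelOK) =
    N , record { ltree = DSTree.ltree D′ ; binary = binary } , r , transfers ,
    R⇒displays D′ r labelOK (Equivalence.to (ContractionProperties.R-preserved C) R)

  consistent⇒refinement : SConsistent σ S λS E → ReconcilableRefinement (SReconcilable σ S λS)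
  consistent⇒refinement (N , k , consistent) with consistentK⇒refinement (N , consistent)
  ... | D , lr , R , D′ , refines , N′ , reconciled = D , lr , R , D′ , refines , N′ , k , reconciled

  refinement⇒consistent : ReconcilableRefinement (SReconcilable σ S λS) → SConsistent σ S λS E
  refinement⇒consistent (D , lr , R , D′ , refines , N , k , reconciled)
    with refinement⇒consistentK (D , lr , R , D′ , refines , N , reconciled)
  ... | N′ , consistent = N′ , k , consistent

mainTheorem4 : ∀ {g s ns : ℕ} (σ : Fin g → Fin s) (E : Fin g → Fin g → Set)
    → (∀ x y → E x y → E y x) → (∀ x → ¬ E x x)
    → (S : RTree ns) (λS : Fin ns → Fin s)
    → (∀ a b → Leaf S a → Leaf S b → λS a ≡ λS b → a ≡ b)
    → (∀ x → ∃[ a ] (Leaf S a × λS a ≡ σ x))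
    → (∀ (k : ℕ) → SConsistentK σ S λS E k ⇔
         Σ (DSTree g) λ Dt → LeastResolved Dt × RofDIs Dt E ×
           Σ (DSTree g) λ D′ → BinaryRefinement D′ Dt × SReconcilableK σ S λS D′ k)
    × (SConsistent σ S λS E ⇔
         Σ (DSTree g) λ Dt → LeastResolved Dt × RofDIs Dt E ×
           Σ (DSTree g) λ D′ → BinaryRefinement D′ Dt × SReconcilable σ S λS D′)
mainTheorem4 _ _ _ _ _ _ _ _ =
  (λ _ → mk⇔ consistentK⇒refinement refinement⇒consistentK) ,
  mk⇔ consistent⇒refinement refinement⇒consistent
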